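{- For a positive integer $n$, let $G_n$ be the graph with vertex set $\{v_i: 1\le i\le n\}\cup\{v_{ij}: 1\le i<j\le n\}$ and edge set $\{v_iv_j: 1\le i<j\le n\}\cup\{v_iv_{ij}: 1\le i<j\le n\}\cup\{v_jv_{ij}:1\le i<j\le n\}$ (i.e., $K_n$ with a path of length $2$ added between each pair of its vertices). If $n\ge r(5,5,5)$, then $\dim_{\mathrm{poc}}(G_n)>3$.
   Context: $r(m,m,m)$ denotes the Ramsey number: the smallest positive integer $r$ such that every $3$-edge-coloring of $K_r$ contains a monochromatic $K_m$. For $x,y\in\mathbb{R}^d$ write $x\prec y$ if $x_i<y_i$ for all $i$. For finite $S\subseteq\mathbb{R}^d$, $D_S$ is the digraph on $S$ with arcs $(x,v)$ whenever $v\prec x$. The competition graph $C(D)$ of a digraph $D$ has the same vertex set, with distinct $x,y$ adjacent iff some vertex $z$ has arcs $(x,z),(y,z)$ in $D$. $\dim_{\mathrm{poc}}(G)$ is the smallest nonnegative integer $d$ such that for some $k\ge 0$ and some finite $S\subseteq\mathbb{R}^d$, $G$ together with $k$ isolated vertices is isomorphic to $C(D_S)$.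
   Formalization: The point sets S in the definition of $\dim_{\mathrm{poc}}$ are taken in ℚ^d rather than $\mathbb{R}^d$. -}

module Defs where

open import Level using (0ℓ)
open import Data.Nat using (ℕ; _≤_)
open import Data.Fin using (Fin; _<_)
open import Data.Vec using (Vec; lookup)
open import Data.Rational using (ℚ) renaming (_<_ to _<ℚ_)
open import Data.Product using (Σ; ∃; ∃-syntax; _×_; _,_)
open import Data.Sum using (_⊎_; inj₁; inj₂)
open import Data.Empty using (⊥)
open import Relation.Nullary using (¬_)
open import Relation.Binary.PropositionalEquality using (_≡_)
open import Function.Bundles using (_↔_; Inverse; _⇔_)
open import Function.Definitions using (Injective)

record Graph : Set₁ where
  field
    V : Set
    E : V → V → Set
open Graph public

_≅_ : Graph → Graph → Set
G ≅ H = Σ (V G ↔ V H) λ f →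
  ∀ x y → E G x y ⇔ E H (Inverse.to f x) (Inverse.to f y)

_+iso_ : Graph → ℕ → Graph
G +iso k = record
  { V = V G ⊎ Fin k
  ; E = λ { (inj₁ x) (inj₁ y) → E G x y ; _ _ → ⊥ } }

Arrows555 : ℕ → Set
Arrows555 r =
  (c : Fin r → Fin r → Fin 3) → (∀ i j → c i j ≡ c j i) →
  Σ (Fin 3) λ col → Σ (Fin 5 → Fin r) λ f →
    Injective _≡_ _≡_ f × (∀ a b → ¬ a ≡ b → c (f a) (f b) ≡ col)

IsRamsey555 : ℕ → Set
IsRamsey555 r = 1 ≤ r × Arrows555 r × (∀ r′ → 1 ≤ r′ → Arrows555 r′ → r ≤ r′)

data GV (n : ℕ) : Set where
  vtx : Fin n → GV n
  mid : (i j : Fin n) → i < j → GV n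

data GE₀ {n : ℕ} : GV n → GV n → Set where
  kk    : ∀ {i j} → i < j → GE₀ (vtx i) (vtx j)
  left  : ∀ {i j} (p : i < j) → GE₀ (vtx i) (mid i j p)
  right : ∀ {i j} (p : i < j) → GE₀ (vtx j) (mid i j p)

GE : {n : ℕ} → GV n → GV n → Set
GE x y = GE₀ x y ⊎ GE₀ y x

Gn : ℕ → Graph
Gn n = record { V = GV n ; E = GE }

_≺_ : {d : ℕ} → Vec ℚ d → Vec ℚ d → Set
_≺_ {d} x y = ∀ (i : Fin d) → lookup x i <ℚ lookup y i

-- competition graph C(D_S), S given as an injective family p : Fin N → ℚ^d.
-- Arc (x,v) in D_S iff v ≺ x; x,y adjacent iff distinct with a common out-neighbour.
CompGraph : {d N : ℕ} → (Fin N → Vec ℚ d) → Graph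
CompGraph {d} {N} p = record
  { V = Fin N
  ; E = λ x y → ¬ x ≡ y × ∃[ z ] (p z ≺ p x × p z ≺ p y) }

PocRepresentable : Graph → ℕ → Set
PocRepresentable G d =
  Σ ℕ λ k → Σ ℕ λ N → Σ (Fin N → Vec ℚ d) λ p →
    Injective _≡_ _≡_ p × ((G +iso k) ≅ CompGraph p)

DimPocGreaterThan : Graph → ℕ → Set
DimPocGreaterThan G m = ∀ d → d ≤ m → ¬ PocRepresentable G d

-- Suppose G_n plus isolated vertices is the competition graph of S ⊆ ℚᵈ, d ≤ 3.  Let X i, M i j
-- be the points of v_i, v_ij and W i j ∈ S a common prey of v_i and v_ij; no point of S lies
-- below both X k and M i j when k ∉ {i, j}.  For d = 0 any two points compete; for 0 < d < 3,
-- repeating a coordinate moves everything into ℚ³.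
--
-- In ℚ³ the X i are pairwise incomparable, so each pair is separated by a coordinate c: it
-- increases strictly from one point to the other while the other coordinates weakly decrease.
-- Colouring pairs by c, Ramsey gives five vertices forming a chain x₀ ◁ ⋯ ◁ x₄ along one
-- coordinate z.  For p ◁ q ◁ r ◁ s, W p r is not below X q, and a coordinate β_pr where
-- X q ≤ W p r cannot be z.  As W q s is not below M p r, it exceeds both preys of
-- {p, r} in some coordinate, which avoids z and β_pr; symmetrically W r p exceeds both preys of
-- {q, s} in a coordinate avoiding z and β_qs.  These two coordinates differ, so β_pr ≠ β_qs.
-- The crossing pairs {0,2}, {1,3}, {2,4}, {0,3}, {1,4} of the chain then form a 5-cycle
-- properly coloured by the two coordinates other than z, which is impossible.
module Submission where

open import Defs
open import Data.Nat using (ℕ; _≤_)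

open import Data.Bool using (if_then_else_)
open import Data.Bool.Properties using (∨-comm)
open import Data.Empty using (⊥; ⊥-elim)
open import Data.Fin as Fin using (Fin; toℕ; fromℕ<; inject≤; _≟_)
open import Data.Fin.Patterns using (0F; 1F; 2F)
open import Data.Fin.Properties
  using (<-cmp; <-irrelevant; punchOut-injective; toℕ-injective; toℕ-fromℕ<; toℕ-inject≤;
         toℕ≤pred[n]; inject≤-injective; injective⇒≤; any?; all?; ¬∀⟶∃¬)
open import Data.List using (List; length; allFin)
open import Data.List.Properties using (length-tabulate)
open import Data.List.Relation.Unary.Linked as Linked using (Linked; []; [-]; _∷_)
open import Data.List.Relation.Unary.Linked.Properties using (AllPairs⇒Linked)
open import Data.List.Relation.Unary.Unique.Propositional using (Unique)
open import Data.List.Relation.Unary.Unique.Propositional.Properties using (allFin⁺)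
open import Data.List.Relation.Binary.Permutation.Propositional using (↭-sym; ↭⇒↭ₛ)
open import Data.List.Relation.Binary.Permutation.Propositional.Properties using (↭-length)
import Data.List.Relation.Binary.Permutation.Setoid.Properties as Permutationₛ
import Data.List.Sort as Sort
open import Data.Nat using (suc; z≤n; s≤s; _+_; _⊓_)
open import Data.Nat.Properties using (≤-trans; ≤-reflexive; m⊓n≤n; m≤n⇒m⊓n≡m)
open import Data.Product using (∃-syntax; _×_; _,_; proj₁; proj₂; uncurry)
import Data.Product as Product
open import Data.Rational as ℚ using (ℚ)
import Data.Rational.Properties as ℚP
open import Data.Sum using (_⊎_; inj₁; inj₂)
open import Data.Sum.Properties using (inj₁-injective)
open import Data.Vec using (Vec; lookup; tabulate)
open import Data.Vec.Properties using (lookup∘tabulate)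
open import Function using (_∘_; _on_)
open import Function.Bundles using (Inverse; Injection; Equivalence)
open import Function.Definitions using (Injective)
open import Function.Properties.Inverse using (↔⇒↣)
import Relation.Binary.Construct.On as On
open import Relation.Binary.Definitions using (tri<; tri≈; tri>)
open import Relation.Binary.PropositionalEquality
  using (_≡_; _≢_; refl; sym; trans; cong; cong₂; subst; subst₂; ≢-sym; setoid;
         module ≡-Reasoning)
open import Relation.Nullary using (¬_; Dec; yes; no; does)
open import Relation.Nullary.Decidable using (map′; _×-dec_; _⊎-dec_; _→-dec_; ¬?)

private variable
  m n d r : ℕ

Fin2-≢-unique : ∀ {x y b : Fin 2} → x ≢ b → y ≢ b → x ≡ y
Fin2-≢-unique {0F} {0F}      _   _   = refl
Fin2-≢-unique {1F} {1F}      _   _   = refl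
Fin2-≢-unique {0F} {1F} {0F} x≢b _   = ⊥-elim (x≢b refl)
Fin2-≢-unique {0F} {1F} {1F} _   y≢b = ⊥-elim (y≢b refl)
Fin2-≢-unique {1F} {0F} {0F} _   y≢b = ⊥-elim (y≢b refl)
Fin2-≢-unique {1F} {0F} {1F} x≢b _   = ⊥-elim (x≢b refl)

Fin3-≢₂-unique : ∀ {a b x y : Fin 3} → a ≢ b → x ≢ a → x ≢ b → y ≢ a → y ≢ b → x ≡ y
Fin3-≢₂-unique {a} {b} {x} {y} a≢b x≢a x≢b y≢a y≢b =
  punchOut-injective a≢x a≢y
    (Fin2-≢-unique (x≢b ∘ punchOut-injective a≢x a≢b) (y≢b ∘ punchOut-injective a≢y a≢b))
  where
  a≢x : a ≢ x
  a≢x = ≢-sym x≢a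
  a≢y : a ≢ y
  a≢y = ≢-sym y≢a

five-cycle-not-2-colourable : ∀ {z a b c d e : Fin 3} →
  a ≢ z → b ≢ z → c ≢ z → d ≢ z → e ≢ z →
  a ≢ b → b ≢ c → c ≢ d → d ≢ e → e ≢ a → ⊥
five-cycle-not-2-colourable {a = a} {c = c} {e = e}
  a≢z b≢z c≢z d≢z e≢z a≢b b≢c c≢d d≢e e≢a = e≢a (sym (trans a≡c c≡e))
  where
  a≡c : a ≡ c
  a≡c = Fin3-≢₂-unique (≢-sym b≢z) a≢z a≢b c≢z (≢-sym b≢c)
  c≡e : c ≡ e
  c≡e = Fin3-≢₂-unique (≢-sym d≢z) c≢z c≢d e≢z (≢-sym d≢e)

third : (i j : Fin (3 + m)) → ∃[ k ] k ≢ i × k ≢ j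
third 0F                    0F                    = 1F , (λ ()) , (λ ())
third 0F                    1F                    = 2F , (λ ()) , (λ ())
third 0F                    (Fin.suc (Fin.suc _)) = 1F , (λ ()) , (λ ())
third 1F                    0F                    = 2F , (λ ()) , (λ ())
third (Fin.suc (Fin.suc _)) 0F                    = 1F , (λ ()) , (λ ())
third (Fin.suc _)           (Fin.suc _)           = 0F , (λ ()) , (λ ())

infixl 9 _!_
_!_ : Vec ℚ d → Fin d → ℚ
_!_ = lookup

¬≺⇒∃≤ : {u v : Vec ℚ d} → ¬ (u ≺ v) → ∃[ c ] v ! c ℚ.≤ u ! c
¬≺⇒∃≤ {d} {u} {v} u⊀v = Product.map₂ ℚP.≮⇒≥ (¬∀⟶∃¬ d _ (λ c → u ! c ℚ.<? v ! c) u⊀v)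

opposite⇒≢ : (u v : Vec ℚ d) {c c′ : Fin d} → u ! c ℚ.< v ! c → v ! c′ ℚ.< u ! c′ → c ≢ c′
opposite⇒≢ _ _ u<v v<u refl = ℚP.<-asym u<v v<u

reindex : (Fin m → Fin d) → Vec ℚ d → Vec ℚ m
reindex f x = tabulate (λ i → x ! f i)

reindex-≺ : {f : Fin m → Fin d} {x y : Vec ℚ d} → x ≺ y → reindex f x ≺ reindex f y
reindex-≺ {f = f} x≺y i =
  subst₂ ℚ._<_ (sym (lookup∘tabulate _ i)) (sym (lookup∘tabulate _ i)) (x≺y (f i))

reindex-≺⁻¹ : {f : Fin m → Fin d} {x y : Vec ℚ d} → (∀ j → ∃[ i ] f i ≡ j) →
              reindex f x ≺ reindex f y → x ≺ y
reindex-≺⁻¹ onto fx≺fy j with onto j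
... | i , refl = subst₂ ℚ._<_ (lookup∘tabulate _ i) (lookup∘tabulate _ i) (fx≺fy i)

clamp : Fin m → Fin (suc d)
clamp {d = d} i = fromℕ< (s≤s (m⊓n≤n (toℕ i) d))

clamp-surjective : suc d ≤ m → ∀ (j : Fin (suc d)) → ∃[ i ] clamp {m} i ≡ j
clamp-surjective {d} d<m j = inject≤ j d<m , toℕ-injective (begin
  toℕ (clamp (inject≤ j d<m)) ≡⟨ toℕ-fromℕ< _ ⟩
  toℕ (inject≤ j d<m) ⊓ d     ≡⟨ cong (_⊓ d) (toℕ-inject≤ j d<m) ⟩
  toℕ j ⊓ d                   ≡⟨ m≤n⇒m⊓n≡m (toℕ≤pred[n] j) ⟩
  toℕ j                       ∎)
  where open ≡-Reasoning

infix 4 _↗⟨_⟩_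
record _↗⟨_⟩_ (u : Vec ℚ d) (c : Fin d) (v : Vec ℚ d) : Set where
  constructor ascends
  field
    rises : u ! c ℚ.< v ! c
    falls : ∀ e → e ≢ c → v ! e ℚ.≤ u ! e
open _↗⟨_⟩_

↗-trans : {u v w : Vec ℚ d} {c : Fin d} → u ↗⟨ c ⟩ v → v ↗⟨ c ⟩ w → u ↗⟨ c ⟩ w
↗-trans (ascends u<v v≤u) (ascends v<w w≤v) =
  ascends (ℚP.<-trans u<v v<w) (λ e e≢c → ℚP.≤-trans (w≤v e e≢c) (v≤u e e≢c))

↗-irrefl : {u : Vec ℚ d} {c : Fin d} → ¬ (u ↗⟨ c ⟩ u)
↗-irrefl u↗u = ℚP.<-irrefl refl (rises u↗u)

↗? : (u : Vec ℚ d) (c : Fin d) (v : Vec ℚ d) → Dec (u ↗⟨ c ⟩ v)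
↗? u c v = map′ (uncurry ascends) (λ u↗v → rises u↗v , falls u↗v)
  ((u ! c ℚ.<? v ! c) ×-dec all? (λ e → ¬? (e ≟ c) →-dec (v ! e ℚ.≤? u ! e)))

Separated : Fin d → Vec ℚ d → Vec ℚ d → Set
Separated c u v = u ↗⟨ c ⟩ v ⊎ v ↗⟨ c ⟩ u

separated? : (c : Fin d) (u v : Vec ℚ d) → Dec (Separated c u v)
separated? c u v = ↗? u c v ⊎-dec ↗? v c u

incomparable⇒separated : {u v : Vec ℚ 3} →
  ∃[ a ] u ! a ℚ.< v ! a → ∃[ b ] v ! b ℚ.< u ! b → ∃[ c ] Separated c u v
incomparable⇒separated {u} {v} (a , uₐ<vₐ) (b , v_b<u_b)
  with any? (λ w → ¬? (w ≟ b) ×-dec (v ! w ℚ.<? u ! w))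
... | no ∄w =
  b , inj₂ (ascends v_b<u_b (λ e e≢b → ℚP.≮⇒≥ (λ vₑ<uₑ → ∄w (e , e≢b , vₑ<uₑ))))
... | yes (w , w≢b , v_w<u_w) = a , inj₁ (ascends uₐ<vₐ v≤u)
  where
  v≤u : ∀ e → e ≢ a → v ! e ℚ.≤ u ! e
  v≤u e e≢a with e ≟ b
  ... | yes refl = ℚP.<⇒≤ v_b<u_b
  ... | no e≢b rewrite Fin3-≢₂-unique (opposite⇒≢ u v uₐ<vₐ v_b<u_b) e≢a e≢b
                         (≢-sym (opposite⇒≢ u v uₐ<vₐ v_w<u_w)) w≢b
    = ℚP.<⇒≤ v_w<u_w

colour : Vec ℚ 3 → Vec ℚ 3 → Fin 3
colour u v =
  if does (separated? 0F u v) then 0F else if does (separated? 1F u v) then 1F else 2F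

colour-comm : (u v : Vec ℚ 3) → colour u v ≡ colour v u
colour-comm u v = cong₂ (λ s t → if s then 0F else if t then 1F else 2F)
  (∨-comm (does (↗? u 0F v)) (does (↗? v 0F u)))
  (∨-comm (does (↗? u 1F v)) (does (↗? v 1F u)))

colour-separates : {u v : Vec ℚ 3} → ∃[ c ] Separated c u v → Separated (colour u v) u v
colour-separates {u} {v} (c , sep) = first-separating (separated? 0F u v) (separated? 1F u v)
  where
  first-separating : (s₀ : Dec (Separated 0F u v)) (s₁ : Dec (Separated 1F u v)) →
                     Separated (if does s₀ then 0F else if does s₁ then 1F else 2F) u v
  first-separating (yes sep₀) _          = sep₀
  first-separating (no _)     (yes sep₁) = sep₁
  first-separating (no ¬sep₀) (no ¬sep₁) = subst (λ c → Separated c u v) c≡2 sep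
    where
    c≡2 : c ≡ 2F
    c≡2 = Fin3-≢₂-unique {0F} {1F} (λ ()) (λ { refl → ¬sep₀ sep }) (λ { refl → ¬sep₁ sep })
                         (λ ()) (λ ())

sorted-chain : (x : Fin m → Vec ℚ d) (c : Fin d) →
               (∀ {a b} → a ≢ b → Separated c (x a) (x b)) →
               ∃[ as ] Linked (_↗⟨ c ⟩_ on x) as × length as ≡ m
sorted-chain {m} x c separated =
  sort (allFin m) ,
  Linked.zipWith step (AllPairs⇒Linked sorted-unique , sort-↗ (allFin m)) ,
  trans (↭-length (sort-↭ (allFin m))) (length-tabulate _)
  where
  open Sort (On.decTotalOrder ℚP.≤-decTotalOrder (λ a → x a ! c))

  sorted-unique : Unique (sort (allFin m))
  sorted-unique = Permutationₛ.Unique-resp-↭ (setoid (Fin m))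
    (↭⇒↭ₛ (↭-sym (sort-↭ (allFin m)))) (allFin⁺ m)

  step : ∀ {a b} → a ≢ b × x a ! c ℚ.≤ x b ! c → x a ↗⟨ c ⟩ x b
  step (a≢b , xₐ≤x_b) with separated a≢b
  ... | inj₁ a↗b = a↗b
  ... | inj₂ b↗a = ⊥-elim (ℚP.<-irrefl refl (ℚP.<-≤-trans (rises b↗a) xₐ≤x_b))

midpoint : Fin n → Fin n → GV n
midpoint i j with <-cmp i j
... | tri< i<j _ _ = mid i j i<j
... | tri≈ _ _ _   = vtx i
... | tri> _ _ j<i = mid j i j<i

midpoint-comm : {i j : Fin n} → i ≢ j → midpoint i j ≡ midpoint j i
midpoint-comm {i = i} {j} i≢j with <-cmp i j | <-cmp j i
... | tri≈ _ i≡j _ | _             = ⊥-elim (i≢j i≡j)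
... | tri< i<j _ _ | tri> _ _ i<j′ = cong (mid i j) (<-irrelevant i<j i<j′)
... | tri< i<j _ _ | tri< _ _ i≮j  = ⊥-elim (i≮j i<j)
... | tri< i<j _ _ | tri≈ _ _ i≮j  = ⊥-elim (i≮j i<j)
... | tri> _ _ j<i | tri< j<i′ _ _ = cong (mid j i) (<-irrelevant j<i j<i′)
... | tri> _ _ j<i | tri> j≮i _ _  = ⊥-elim (j≮i j<i)
... | tri> _ _ j<i | tri≈ j≮i _ _  = ⊥-elim (j≮i j<i)

vtx-adj-midpoint : {i j : Fin n} → i ≢ j → GE (vtx i) (midpoint i j)
vtx-adj-midpoint {i = i} {j} i≢j with <-cmp i j
... | tri< i<j _ _ = inj₁ (left i<j)
... | tri≈ _ i≡j _ = ⊥-elim (i≢j i≡j)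
... | tri> _ _ j<i = inj₁ (right j<i)

vtx-nonadj-midpoint : {i j k : Fin n} → i ≢ j → k ≢ i → k ≢ j → ¬ GE (vtx k) (midpoint i j)
vtx-nonadj-midpoint {i = i} {j} i≢j k≢i k≢j with <-cmp i j
... | tri< _ _ _   = λ { (inj₁ (left _)) → k≢i refl ; (inj₁ (right _)) → k≢j refl ; (inj₂ ()) }
... | tri≈ _ i≡j _ = ⊥-elim (i≢j i≡j)
... | tri> _ _ _   = λ { (inj₁ (left _)) → k≢j refl ; (inj₁ (right _)) → k≢i refl ; (inj₂ ()) }

vtx≢midpoint : {i j k : Fin n} → i ≢ j → vtx k ≢ midpoint i j
vtx≢midpoint {i = i} {j} i≢j with <-cmp i j
... | tri< _ _ _   = λ ()
... | tri≈ _ i≡j _ = ⊥-elim (i≢j i≡j)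
... | tri> _ _ _   = λ ()

record Realisation (n d : ℕ) : Set where
  field
    N              : ℕ
    S              : Fin N → Vec ℚ d
    X              : Fin n → Vec ℚ d
    M              : Fin n → Fin n → Vec ℚ d
    prey           : Fin n → Fin n → Fin N
    M-comm         : ∀ {i j} → i ≢ j → M i j ≡ M j i
    prey-below     : ∀ {i j} → i ≢ j → S (prey i j) ≺ X i × S (prey i j) ≺ M i j
    no-common-prey : ∀ {i j k} → i ≢ j → k ≢ i → k ≢ j →
                     ∀ s → ¬ (S s ≺ X k × S s ≺ M i j)

  W : Fin n → Fin n → Vec ℚ d
  W i j = S (prey i j)

realisation : ∀ {k N} (p : Fin N → Vec ℚ d) → (Gn n +iso k) ≅ CompGraph p → Realisation n d
realisation {d} {n} {N = N} p (bijection , adjacency) = record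
  { N              = N
  ; S              = p
  ; X              = point ∘ vtx
  ; M              = λ i j → point (midpoint i j)
  ; prey           = prey
  ; M-comm         = cong point ∘ midpoint-comm
  ; prey-below     = prey-below
  ; no-common-prey = λ i≢j k≢i k≢j s below →
      vtx-nonadj-midpoint i≢j k≢i k≢j (common-prey⇒adjacent (vtx≢midpoint i≢j) s below)
  }
  where
  vertex : GV n → Fin N
  vertex v = Inverse.to bijection (inj₁ v)

  point : GV n → Vec ℚ d
  point = p ∘ vertex

  adjacent⇒common-prey : ∀ {u v} → GE u v → ∃[ s ] p s ≺ point u × p s ≺ point v
  adjacent⇒common-prey = proj₂ ∘ Equivalence.to (adjacency (inj₁ _) (inj₁ _))

  common-prey⇒adjacent : ∀ {u v} → u ≢ v → ∀ s → p s ≺ point u × p s ≺ point v → GE u v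
  common-prey⇒adjacent u≢v s below = Equivalence.from (adjacency (inj₁ _) (inj₁ _))
    (u≢v ∘ inj₁-injective ∘ Injection.injective (↔⇒↣ bijection) , s , below)

  prey : Fin n → Fin n → Fin N
  prey i j with i ≟ j
  ... | yes _  = vertex (vtx i)
  ... | no i≢j = proj₁ (adjacent⇒common-prey (vtx-adj-midpoint i≢j))

  prey-below : ∀ {i j} → i ≢ j →
               p (prey i j) ≺ point (vtx i) × p (prey i j) ≺ point (midpoint i j)
  prey-below {i} {j} i≢j with i ≟ j
  ... | yes i≡j = ⊥-elim (i≢j i≡j)
  ... | no i≢j′ = proj₂ (adjacent⇒common-prey (vtx-adj-midpoint i≢j′))

Realisation-reindex : {f : Fin m → Fin d} → (∀ j → ∃[ i ] f i ≡ j) →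
                      Realisation n d → Realisation n m
Realisation-reindex {f = f} onto R = record
  { N              = N
  ; S              = reindex f ∘ S
  ; X              = reindex f ∘ X
  ; M              = λ i j → reindex f (M i j)
  ; prey           = prey
  ; M-comm         = cong (reindex f) ∘ M-comm
  ; prey-below     = λ {i} {j} i≢j →
      Product.map (reindex-≺ {x = W i j} {X i}) (reindex-≺ {x = W i j} {M i j}) (prey-below i≢j)
  ; no-common-prey = λ {i} {j} {k} i≢j k≢i k≢j s →
      no-common-prey i≢j k≢i k≢j s
        ∘ Product.map (reindex-≺⁻¹ {x = S s} {X k} onto) (reindex-≺⁻¹ {x = S s} {M i j} onto)
  }
  where open Realisation R

no-Realisation₀ : 3 ≤ n → ¬ Realisation n 0
no-Realisation₀ (s≤s (s≤s (s≤s _))) R =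
  no-common-prey {0F} {1F} {2F} (λ ()) (λ ()) (λ ()) (prey 0F 1F) ((λ ()) , (λ ()))
  where open Realisation R

module _ (R : Realisation n d) where
  open Realisation R

  prey<X : ∀ {i j} → i ≢ j → ∀ c → W i j ! c ℚ.< X i ! c
  prey<X i≢j = proj₁ (prey-below i≢j)

  X≤prey-somewhere : ∀ {i j k} → i ≢ j → k ≢ i → k ≢ j → ∃[ c ] X k ! c ℚ.≤ W i j ! c
  X≤prey-somewhere {i} {j} {k} i≢j k≢i k≢j = ¬≺⇒∃≤ {u = W i j} {X k}
    (λ W≺X → no-common-prey i≢j k≢i k≢j _ (W≺X , proj₂ (prey-below i≢j)))

  X-exceeds-somewhere : ∀ {i j k} → i ≢ j → k ≢ i → k ≢ j → ∃[ c ] X j ! c ℚ.< X i ! c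
  X-exceeds-somewhere i≢j k≢i k≢j with X≤prey-somewhere (≢-sym k≢i) (≢-sym i≢j) (≢-sym k≢j)
  ... | c , Xⱼ≤W = c , ℚP.≤-<-trans Xⱼ≤W (prey<X (≢-sym k≢i) c)

  exceeds-pair-preys : ∀ {i j k l} → i ≢ j → k ≢ i → k ≢ j → k ≢ l →
                       ∃[ e ] W i j ! e ℚ.< W k l ! e × W j i ! e ℚ.< W k l ! e
  exceeds-pair-preys {i} {j} {k} {l} i≢j k≢i k≢j k≢l
    with ¬≺⇒∃≤ {u = W k l} {M i j}
           (λ W≺M → no-common-prey i≢j k≢i k≢j _ (proj₁ (prey-below k≢l) , W≺M))
  ... | e , M≤W =
    e , ℚP.<-≤-trans (proj₂ (prey-below i≢j) e) M≤W
      , ℚP.<-≤-trans (subst (λ M′ → W j i ! e ℚ.< M′ ! e) (M-comm (≢-sym i≢j))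
                            (proj₂ (prey-below (≢-sym i≢j)) e)) M≤W

module Chain (R : Realisation n d) (z : Fin d) where
  open Realisation R

  infix 4 _◁_
  _◁_ : Fin n → Fin n → Set
  i ◁ k = X i ↗⟨ z ⟩ X k

  ◁-trans : ∀ {i j k} → i ◁ j → j ◁ k → i ◁ k
  ◁-trans = ↗-trans

  ◁⇒≢ : ∀ {i k} → i ◁ k → i ≢ k
  ◁⇒≢ i◁k refl = ↗-irrefl i◁k

  record OffAxisBlock (k i j : Fin n) : Set where
    field
      coord   : Fin d
      coord≢z : coord ≢ z
      X≤prey  : X k ! coord ℚ.≤ W i j ! coord
  open OffAxisBlock public

  onAxisBlock : ∀ {i j k} → j ◁ k → k ◁ i → X k ! z ℚ.≤ W i j ! z
  onAxisBlock {i} {j} {k} j◁k k◁i =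
    on-axis (X≤prey-somewhere R i≢j (◁⇒≢ k◁i) (≢-sym (◁⇒≢ j◁k)))
    where
    i≢j : i ≢ j
    i≢j = ≢-sym (◁⇒≢ (◁-trans j◁k k◁i))

    on-axis : ∃[ c ] X k ! c ℚ.≤ W i j ! c → X k ! z ℚ.≤ W i j ! z
    on-axis (c , Xₖ≤W) with c ≟ z
    ... | yes refl = Xₖ≤W
    ... | no c≢z   = ⊥-elim (ℚP.<-irrefl refl
          (ℚP.≤-<-trans (ℚP.≤-trans (falls k◁i c c≢z) Xₖ≤W) (prey<X R i≢j c)))

  offAxisBlock : ∀ {i j k} → i ◁ k → k ◁ j → OffAxisBlock k i j
  offAxisBlock {i} {j} {k} i◁k k◁j =
    off-axis (X≤prey-somewhere R i≢j (≢-sym (◁⇒≢ i◁k)) (◁⇒≢ k◁j))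
    where
    i≢j : i ≢ j
    i≢j = ◁⇒≢ (◁-trans i◁k k◁j)

    off-axis : ∃[ c ] X k ! c ℚ.≤ W i j ! c → OffAxisBlock k i j
    off-axis (c , Xₖ≤W) = record { coord = c ; coord≢z = c≢z ; X≤prey = Xₖ≤W }
      where
      c≢z : c ≢ z
      c≢z refl = ℚP.<-irrefl refl
        (ℚP.<-≤-trans (ℚP.<-trans (prey<X R i≢j z) (rises i◁k)) Xₖ≤W)

  OffAxisBlock-◁ : ∀ {i j k m} → m ◁ k → OffAxisBlock m i j → OffAxisBlock k i j
  OffAxisBlock-◁ m◁k b = record
    { coord   = coord b
    ; coord≢z = coord≢z b
    ; X≤prey  = ℚP.≤-trans (falls m◁k (coord b) (coord≢z b)) (X≤prey b)
    }

module _ (R : Realisation n 3) (z : Fin 3) where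
  open Realisation R
  open Chain R z

  blocks-differ : ∀ {p q r s} → p ◁ q → q ◁ r → r ◁ s →
                  (b : OffAxisBlock q p r) (b′ : OffAxisBlock r q s) → coord b ≢ coord b′
  blocks-differ {p} {q} {r} {s} p◁q q◁r r◁s b b′ β≡β′ =
    escapes-agree (exceeds-pair-preys R r≢p q≢r q≢p q≢s) (exceeds-pair-preys R s≢q r≢s r≢q r≢p)
    where
    q≢r : q ≢ r
    q≢r = ◁⇒≢ q◁r
    r≢s : r ≢ s
    r≢s = ◁⇒≢ r◁s
    q≢s : q ≢ s
    q≢s = ◁⇒≢ (◁-trans q◁r r◁s)
    r≢p : r ≢ p
    r≢p = ≢-sym (◁⇒≢ (◁-trans p◁q q◁r))
    q≢p : q ≢ p
    q≢p = ≢-sym (◁⇒≢ p◁q)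
    s≢q : s ≢ q
    s≢q = ≢-sym q≢s
    r≢q : r ≢ q
    r≢q = ≢-sym q≢r

    escapes-agree : ∃[ e ] W r p ! e ℚ.< W q s ! e × W p r ! e ℚ.< W q s ! e →
                    ∃[ e′ ] W s q ! e′ ℚ.< W r p ! e′ × W q s ! e′ ℚ.< W r p ! e′ → ⊥
    escapes-agree (e , Wrp<Wqs , Wpr<Wqs) (e′ , Wsq<Wrp , Wqs<Wrp) =
      opposite⇒≢ (W r p) (W q s) Wrp<Wqs Wqs<Wrp
        (Fin3-≢₂-unique (≢-sym (coord≢z b)) e≢z e≢β e′≢z e′≢β)
      where
      e≢z : e ≢ z
      e≢z = opposite⇒≢ (W r p) (W q s) Wrp<Wqs
              (ℚP.<-≤-trans (prey<X R q≢s z) (onAxisBlock p◁q q◁r))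
      e≢β : e ≢ coord b
      e≢β = opposite⇒≢ (W p r) (W q s) Wpr<Wqs (ℚP.<-≤-trans (prey<X R q≢s _) (X≤prey b))
      e′≢z : e′ ≢ z
      e′≢z = opposite⇒≢ (W s q) (W r p) Wsq<Wrp
               (ℚP.<-≤-trans (prey<X R r≢p z) (onAxisBlock q◁r r◁s))
      e′≢β : e′ ≢ coord b
      e′≢β = subst (e′ ≢_) (sym β≡β′)
               (opposite⇒≢ (W q s) (W r p) Wqs<Wrp (ℚP.<-≤-trans (prey<X R r≢p _) (X≤prey b′)))

  no-chain₅ : ∀ {x₀ x₁ x₂ x₃ x₄} → x₀ ◁ x₁ → x₁ ◁ x₂ → x₂ ◁ x₃ → x₃ ◁ x₄ → ⊥
  no-chain₅ {x₀} {x₁} {x₂} {x₃} {x₄} h₀₁ h₁₂ h₂₃ h₃₄ =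
    five-cycle-not-2-colourable
      (coord≢z b₀₂) (coord≢z b₁₃) (coord≢z b₂₄) (coord≢z b₀₃) (coord≢z b₁₄)
      (blocks-differ h₀₁ h₁₂ h₂₃ b₀₂ b₁₃)
      (blocks-differ h₁₂ h₂₃ h₃₄ b₁₃ b₂₄)
      (≢-sym (blocks-differ h₀₂ h₂₃ h₃₄ (OffAxisBlock-◁ h₁₂ b₀₃) b₂₄))
      (blocks-differ h₀₁ h₁₃ h₃₄ b₀₃ (OffAxisBlock-◁ h₂₃ b₁₄))
      (≢-sym (blocks-differ h₀₁ h₁₂ h₂₄ b₀₂ b₁₄))
    where
    h₀₂ : x₀ ◁ x₂
    h₀₂ = ◁-trans h₀₁ h₁₂
    h₁₃ : x₁ ◁ x₃
    h₁₃ = ◁-trans h₁₂ h₂₃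
    h₂₄ : x₂ ◁ x₄
    h₂₄ = ◁-trans h₂₃ h₃₄
    b₀₂ : OffAxisBlock x₁ x₀ x₂
    b₀₂ = offAxisBlock h₀₁ h₁₂
    b₁₃ : OffAxisBlock x₂ x₁ x₃
    b₁₃ = offAxisBlock h₁₂ h₂₃
    b₂₄ : OffAxisBlock x₃ x₂ x₄
    b₂₄ = offAxisBlock h₂₃ h₃₄
    b₀₃ : OffAxisBlock x₁ x₀ x₃
    b₀₃ = offAxisBlock h₀₁ h₁₃
    b₁₄ : OffAxisBlock x₂ x₁ x₄
    b₁₄ = offAxisBlock h₁₂ h₂₄

  no-long-chain : (g : Fin m → Fin n) {as : List (Fin m)} →
                  Linked (_◁_ on g) as → 5 ≤ length as → ⊥
  no-long-chain g (h₀₁ ∷ h₁₂ ∷ h₂₃ ∷ h₃₄ ∷ _) _ = no-chain₅ h₀₁ h₁₂ h₂₃ h₃₄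
  no-long-chain g []                ()
  no-long-chain g [-]               (s≤s ())
  no-long-chain g (_ ∷ [-])         (s≤s (s≤s ()))
  no-long-chain g (_ ∷ _ ∷ [-])     (s≤s (s≤s (s≤s ())))
  no-long-chain g (_ ∷ _ ∷ _ ∷ [-]) (s≤s (s≤s (s≤s (s≤s ()))))

module _ (R : Realisation n 3) where
  open Realisation R

  colour-separates-X : ∀ {i j k} → i ≢ j → k ≢ i → k ≢ j →
                       Separated (colour (X i) (X j)) (X i) (X j)
  colour-separates-X i≢j k≢i k≢j = colour-separates (incomparable⇒separated
    (X-exceeds-somewhere R (≢-sym i≢j) k≢j k≢i) (X-exceeds-somewhere R i≢j k≢i k≢j))

  no-monochromatic₅ : (c : Fin 3) (g : Fin 5 → Fin n) → Injective _≡_ _≡_ g →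
                      (∀ a b → a ≢ b → colour (X (g a)) (X (g b)) ≡ c) → ⊥
  no-monochromatic₅ c g g-injective monochromatic =
    let (_ , chain , length≡5) = sorted-chain (X ∘ g) c separated
    in no-long-chain R c g chain (≤-reflexive (sym length≡5))
    where
    separated : ∀ {a b} → a ≢ b → Separated c (X (g a)) (X (g b))
    separated {a} {b} a≢b with third a b
    ... | t , t≢a , t≢b = subst (λ c → Separated c (X (g a)) (X (g b))) (monochromatic a b a≢b)
      (colour-separates-X (a≢b ∘ g-injective) (t≢a ∘ g-injective) (t≢b ∘ g-injective))

Arrows555⇒5≤ : Arrows555 r → 5 ≤ r
Arrows555⇒5≤ arrows =
  injective⇒≤ (proj₁ (proj₂ (proj₂ (arrows (λ _ _ → 0F) (λ _ _ → refl)))))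

no-Realisation₃ : Arrows555 r → r ≤ n → ¬ Realisation n 3
no-Realisation₃ {r} {n} arrows r≤n R =
  let (c , f , f-injective , monochromatic) =
        arrows colouring (λ a b → colour-comm (X (ι a)) (X (ι b)))
  in no-monochromatic₅ R c (ι ∘ f) (f-injective ∘ inject≤-injective r≤n r≤n _ _) monochromatic
  where
  open Realisation R

  ι : Fin r → Fin n
  ι a = inject≤ a r≤n

  colouring : Fin r → Fin r → Fin 3
  colouring a b = colour (X (ι a)) (X (ι b))

mainTheorem2 : (n r : ℕ) → IsRamsey555 r → r ≤ n → DimPocGreaterThan (Gn n) 3
mainTheorem2 n r (_ , arrows , _) r≤n 0 _ (_ , _ , p , _ , G≅C) =
  no-Realisation₀ (≤-trans (s≤s (s≤s (s≤s z≤n))) (≤-trans (Arrows555⇒5≤ arrows) r≤n))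
    (realisation p G≅C)
mainTheorem2 n r (_ , arrows , _) r≤n (suc d) d<3 (_ , _ , p , _ , G≅C) =
  no-Realisation₃ arrows r≤n (Realisation-reindex (clamp-surjective d<3) (realisation p G≅C))
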